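{- Let $(C,\phi)$ be a multistate monotone system with component state sets $\mathcal{S}_i=\{0,1,\ldots,m_i\}$, $m_i\ge1$, let $k\in\{1,\ldots,M\}$ and $e\in C$. Then $$d(\phi_k)=d(\phi_k((m_e)_e,\cdot))-d(\phi_k((m_e-1)_e,\cdot)),$$ where $\phi_k((r)_e,\cdot)$ denotes the binary-valued non-decreasing function on $\prod_{i\in C\setminus\{e\}}\mathcal{S}_i$ obtained from $\phi_k$ by fixing the state of component $e$ to $r$, regarded as the $1$-level structure function of a multistate monotone system with component set $C\setminus\{e\}$.
   Context: A multistate monotone system (MMS) $(C,\phi)$ has component set $C$ (finite, $n=|C|$), component state sets $\mathcal{S}_i=\{0,1,\ldots,m_i\}$, component state space $\mathfrak{C}=\prod_{i\in C}\mathcal{S}_i$, system state set $\{0,1,\ldots,M\}$, and a structure function $\phi:\mathfrak{C}\to\{0,\ldots,M\}$ non-decreasing in each argument; $\phi_k(\bm{x})=\mathrm{I}(\phi(\bm{x})\ge k)$. Vectors are ordered componentwise. A minimal $k$-level path vector is $\bm{x}\in\mathfrak{C}$ with $\phi(\bm{x})\ge k$ and $\phi(\bm{y})<k$ for all $\bm{y}\le\bm{x}$, $\bm{y}\ne\bm{x}$; $\mathfrak{P}_k$ is the set of these, and $\mathrm{cl}(\mathfrak{P}_k)$ is the smallest set containing $\mathfrak{P}_k$ closed under componentwise maximum $\vee$. A formation of $\bm{x}\in\mathrm{cl}(\mathfrak{P}_k)$ is a nonempty subset $\{\bm{x}_{i_1},\ldots,\bm{x}_{i_j}\}\subseteq\mathfrak{P}_k$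 with $\bm{x}=\bm{x}_{i_1}\vee\cdots\vee\bm{x}_{i_j}$, odd/even according to parity of $j$. $\delta_k(\bm{x})=$ (number of odd formations) $-$ (number of even formations) for $\bm{x}\in\mathrm{cl}(\mathfrak{P}_k)$, $\delta_k(\bm{x})=0$ otherwise. The signed domination of $\phi_k$ is $d(\phi_k)=\delta_k(\bm{m})$, with $\bm{m}$ the vector of maximal states $(m_i)_{i\in C}$. The same definitions apply to the restricted systems on $C\setminus\{e\}$ (with maximal vector $(m_i)_{i\ne e}$; if $C\setminus\{e\}=\emptyset$ the state space is a single point, and $d$ equals the constant value of the function). -}

module Defs where

open import Data.Nat using (ℕ; zero; suc; _≤_; _⊔_; _≤ᵇ_; _<ᵇ_; _≡ᵇ_)
open import Data.Nat.Base using (_%_)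
open import Data.Bool using (Bool; true; false; _∧_; _∨_; not; if_then_else_)
open import Data.Fin using (Fin)
open import Data.List using (List; []; _∷_; map; _++_; concatMap; upTo; allFin; filterᵇ; length; foldr)
open import Data.Integer using (ℤ; +_; _-_)
import Data.Vec.Functional as V

Vec : ℕ → Set
Vec n = Fin n → ℕ

InStateSpace : ∀ {n} → Vec n → Vec n → Set
InStateSpace m x = ∀ i → x i ≤ m i

_≤ᵥ_ : ∀ {n} → Vec n → Vec n → Set
x ≤ᵥ y = ∀ i → x i ≤ y i

allStates : ∀ {n} → Vec n → List (Vec n)
allStates {zero}  m = (λ ()) ∷ []
allStates {suc n} m =
  concatMap (λ a → map (λ r → a V.∷ r) (allStates (V.tail m))) (upTo (suc (V.head m)))

allᵇ : ∀ {A : Set} → (A → Bool) → List A → Bool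
allᵇ p []       = true
allᵇ p (x ∷ xs) = p x ∧ allᵇ p xs

_≤ᵇᵥ_ : ∀ {n} → Vec n → Vec n → Bool
_≤ᵇᵥ_ {n} x y = allᵇ (λ i → x i ≤ᵇ y i) (allFin n)

_≡ᵇᵥ_ : ∀ {n} → Vec n → Vec n → Bool
_≡ᵇᵥ_ {n} x y = allᵇ (λ i → x i ≡ᵇ y i) (allFin n)

_∨ᵥ_ : ∀ {n} → Vec n → Vec n → Vec n
(x ∨ᵥ y) i = x i ⊔ y i

level : ∀ {n} → (Vec n → ℕ) → ℕ → Vec n → ℕ
level φ k x = if k ≤ᵇ φ x then 1 else 0

isMinPath : ∀ {n} → Vec n → (Vec n → ℕ) → ℕ → Vec n → Bool
isMinPath m φ k x =
  (k ≤ᵇ φ x) ∧ allᵇ (λ y → not ((y ≤ᵇᵥ x) ∧ not (y ≡ᵇᵥ x)) ∨ (φ y <ᵇ k)) (allStates m)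

-- 𝔓_k, as a duplicate-free list
minPaths : ∀ {n} → Vec n → (Vec n → ℕ) → ℕ → List (Vec n)
minPaths m φ k = filterᵇ (isMinPath m φ k) (allStates m)

subsets : ∀ {A : Set} → List A → List (List A)
subsets []       = [] ∷ []
subsets (x ∷ xs) = map (x ∷_) (subsets xs) ++ subsets xs

isFormation : ∀ {n} → Vec n → List (Vec n) → Bool
isFormation x []       = false
isFormation x (y ∷ ys) = foldr _∨ᵥ_ y ys ≡ᵇᵥ x

isOdd : ℕ → Bool
isOdd j = (j % 2) ≡ᵇ 1

oddFormations : ∀ {n} → Vec n → (Vec n → ℕ) → ℕ → Vec n → ℕ
oddFormations m φ k x =
  length (filterᵇ (λ S → isFormation x S ∧ isOdd (length S)) (subsets (minPaths m φ k)))

evenFormations : ∀ {n} → Vec n → (Vec n → ℕ) → ℕ → Vec n → ℕ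
evenFormations m φ k x =
  length (filterᵇ (λ S → isFormation x S ∧ not (isOdd (length S))) (subsets (minPaths m φ k)))

-- δ_k(x) (automatically 0 when x ∉ cl(𝔓_k), as then there are no formations)
δ : ∀ {n} → Vec n → (Vec n → ℕ) → ℕ → Vec n → ℤ
δ m φ k x = + oddFormations m φ k x - + evenFormations m φ k x

d : ∀ {n} → Vec n → (Vec n → ℕ) → ℕ → ℤ
d m φ k = δ m φ k m

-- φ_k((r)_e, ·) on ∏_{i ≠ e} S_i (components indexed via punchIn e)
fixAt : ∀ {n} → (Vec (suc n) → ℕ) → ℕ → Fin (suc n) → ℕ → Vec n → ℕ
fixAt φ k e r y = level φ k (V.insertAt y e r)

dFix : ∀ {n} → Vec (suc n) → (Vec (suc n) → ℕ) → ℕ → Fin (suc n) → ℕ → ℤ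
dFix m φ k e r = d (V.removeAt m e) (fixAt φ k e r) 1

-- Write Δ m g for the mixed backward difference of g at the top corner m of the
-- state space.  Expanding the signed domination over the formations of m, each
-- formation {p₁,…,pⱼ} contributes ±[p₁ ∨ ⋯ ∨ pⱼ = m], and [v = m] = Δ m [v ≤ ·]
-- because every mᵢ ≥ 1.  Pulling Δ out of the sum leaves, under Δ, the
-- inclusion–exclusion expansion of [some minimal path vector lies below y], which
-- is φₖ(y).  Hence d(φₖ) = Δ m φₖ for every monotone system, in particular for the
-- restricted ones, and the theorem follows by taking the difference in coordinate
-- e first: Δ m φₖ = Δ over C∖{e} of φₖ((mₑ)ₑ,·) − φₖ((mₑ−1)ₑ,·).
module Submission where

open import Defs
open import Algebra using (CommutativeMonoid)
open import Data.Bool using (Bool; true; false; _∧_; _∨_; not; if_then_else_; T)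
open import Data.Bool.Properties using (T-∧; ∧-identityʳ; ∧-commutativeMonoid)
open import Data.Bool.ListAction using (all; any)
open import Data.Empty using (⊥-elim)
open import Data.Fin using (Fin; zero; suc; punchIn)
open import Data.Integer using (ℤ; +_; -_; _+_; _-_; _*_; 0ℤ; 1ℤ; -1ℤ)
import Data.Integer.Properties as ℤ
open import Data.Integer.Tactic.RingSolver using (solve-∀)
open import Data.List using (List; []; _∷_; _++_; map; foldr; length; filterᵇ; allFin; upTo)
open import Data.List.Membership.Propositional using (_∈_; find; lose)
open import Data.List.Membership.Propositional.Properties
  using (∈-allFin; ∈-filter⁺; ∈-filter⁻; ∈-map⁺; ∈-map⁻; ∈-++⁻; ∈-concatMap⁺; ∈-concatMap⁻; ∈-upTo⁺; ∈-upTo⁻)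
open import Data.List.Relation.Unary.All as All using (All)
open import Data.List.Relation.Unary.All.Properties using (all⁺; all⁻; ¬All⇒Any¬)
open import Data.List.Relation.Unary.Any using (here; there)
open import Data.List.Relation.Unary.Any.Properties using (any⁺; any⁻)
import Data.Nat as ℕ
open import Data.Nat using (ℕ; zero; suc; _≤_; _<_; _∸_; _≤ᵇ_; _<ᵇ_; _≡ᵇ_; z≤n; s≤s)
open import Data.Nat.Induction using (<-wellFounded)
open import Data.Nat.Properties
open import Data.Product using (∃-syntax; _×_; _,_; proj₁)
open import Data.Sum using (inj₁; inj₂)
import Data.Vec.Functional as V
open import Function using (_∘_; Equivalence)
import Induction.WellFounded as WF
open import Relation.Binary.Construct.On using (wellFounded)
open import Relation.Binary.PropositionalEquality
open import Relation.Nullary using (¬_; contradiction; yes; no)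
open import Relation.Nullary.Decidable using (T?)

open import Algebra.Properties.CommutativeSemigroup
  (CommutativeMonoid.commutativeSemigroup ∧-commutativeMonoid) using () renaming (x∙yz≈y∙xz to ∧-left-comm)

T-injective : ∀ {a b} → (T a → T b) → (T b → T a) → a ≡ b
T-injective {true}  {true}  _ _ = refl
T-injective {true}  {false} f _ = ⊥-elim (f _)
T-injective {false} {true}  _ g = ⊥-elim (g _)
T-injective {false} {false} _ _ = refl

𝟙 : Bool → ℤ
𝟙 true  = 1ℤ
𝟙 false = 0ℤ

𝟙-∧ : ∀ a b → 𝟙 (a ∧ b) ≡ 𝟙 a * 𝟙 b
𝟙-∧ true  b = sym (ℤ.*-identityˡ (𝟙 b))
𝟙-∧ false b = sym (ℤ.*-zeroˡ (𝟙 b))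

𝟙-T : ∀ {b} → T b → 𝟙 b ≡ 1ℤ
𝟙-T {true} _ = refl

𝟙-¬T : ∀ {b} → ¬ T b → 𝟙 b ≡ 0ℤ
𝟙-¬T {true}  ¬t = contradiction _ ¬t
𝟙-¬T {false} _  = refl

𝟙-≤ᵇ-pred : ∀ {v m} → 1 ≤ m → v ≤ m → 𝟙 (v ≤ᵇ m) - 𝟙 (v ≤ᵇ m ∸ 1) ≡ 𝟙 (v ≡ᵇ m)
𝟙-≤ᵇ-pred {v} {suc m} _ v≤m with m≤n⇒m<n∨m≡n v≤m
... | inj₁ (s≤s v≤m-1) = trans
  (cong₂ _-_ (𝟙-T (≤⇒≤ᵇ v≤m)) (𝟙-T (≤⇒≤ᵇ v≤m-1)))
  (sym (𝟙-¬T (λ t → <⇒≢ (s≤s v≤m-1) (≡ᵇ⇒≡ v (suc m) t))))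
... | inj₂ refl = trans
  (cong₂ _-_ (𝟙-T (≤⇒≤ᵇ (≤-refl {suc m}))) (𝟙-¬T (λ t → n≮n m (≤ᵇ⇒≤ (suc m) m t))))
  (sym (𝟙-T (≡⇒≡ᵇ (suc m) (suc m) refl)))

module _ {A : Set} (p : A → Bool) where

  allᵇ≡all : ∀ xs → allᵇ p xs ≡ all p xs
  allᵇ≡all []       = refl
  allᵇ≡all (x ∷ xs) = cong (p x ∧_) (allᵇ≡all xs)

  allᵇ⁺ : ∀ {xs} → T (allᵇ p xs) → All (T ∘ p) xs
  allᵇ⁺ {xs} t = all⁺ p xs (subst T (allᵇ≡all xs) t)

  allᵇ⁻ : ∀ {xs} → All (T ∘ p) xs → T (allᵇ p xs)
  allᵇ⁻ {xs} ps = subst T (sym (allᵇ≡all xs)) (all⁻ p ps)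

allᵇ-allFin⁺ : ∀ {n} (p : Fin n → Bool) → T (allᵇ p (allFin n)) → ∀ i → T (p i)
allᵇ-allFin⁺ p t i = All.lookup (allᵇ⁺ p t) (∈-allFin i)

allᵇ-allFin⁻ : ∀ {n} (p : Fin n → Bool) → (∀ i → T (p i)) → T (allᵇ p (allFin n))
allᵇ-allFin⁻ {n} p h = allᵇ⁻ p {allFin n} (All.tabulate λ {i} _ → h i)

allᵇ-allFin-suc : ∀ {n} (p : Fin (suc n) → Bool) →
  allᵇ p (allFin (suc n)) ≡ p zero ∧ allᵇ (p ∘ suc) (allFin n)
allᵇ-allFin-suc p = T-injective
  (λ t → let h = allᵇ-allFin⁺ p t in Equivalence.from T-∧ (h zero , allᵇ-allFin⁻ (p ∘ suc) (h ∘ suc)))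
  (λ t → let h₀ , hₛ = Equivalence.to T-∧ t in
         allᵇ-allFin⁻ p λ { zero → h₀ ; (suc i) → allᵇ-allFin⁺ (p ∘ suc) hₛ i })

module _ {n} (x y : Vec n) where

  ≤ᵇᵥ⇒≤ᵥ : T (x ≤ᵇᵥ y) → x ≤ᵥ y
  ≤ᵇᵥ⇒≤ᵥ t i = ≤ᵇ⇒≤ (x i) (y i) (allᵇ-allFin⁺ _ t i)

  ≤ᵥ⇒≤ᵇᵥ : x ≤ᵥ y → T (x ≤ᵇᵥ y)
  ≤ᵥ⇒≤ᵇᵥ x≤y = allᵇ-allFin⁻ _ (λ i → ≤⇒≤ᵇ (x≤y i))

  ≗⇒≡ᵇᵥ : x ≗ y → T (x ≡ᵇᵥ y)
  ≗⇒≡ᵇᵥ x≗y = allᵇ-allFin⁻ _ (λ i → ≡⇒≡ᵇ (x i) (y i) (x≗y i))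

≤ᵥ-refl : ∀ {n} {x : Vec n} → x ≤ᵥ x
≤ᵥ-refl i = ≤-refl

≤ᵥ-trans : ∀ {n} {x y z : Vec n} → x ≤ᵥ y → y ≤ᵥ z → x ≤ᵥ z
≤ᵥ-trans x≤y y≤z i = ≤-trans (x≤y i) (y≤z i)

∨ᵥ-≤ᵇᵥ : ∀ {n} (a b y : Vec n) → ((a ∨ᵥ b) ≤ᵇᵥ y) ≡ (a ≤ᵇᵥ y) ∧ (b ≤ᵇᵥ y)
∨ᵥ-≤ᵇᵥ a b y = T-injective
  (λ t → let a∨b≤y = ≤ᵇᵥ⇒≤ᵥ (a ∨ᵥ b) y t in Equivalence.from T-∧
    ( ≤ᵥ⇒≤ᵇᵥ a y (λ i → ≤-trans (m≤m⊔n (a i) (b i)) (a∨b≤y i))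
    , ≤ᵥ⇒≤ᵇᵥ b y (λ i → ≤-trans (m≤n⊔m (a i) (b i)) (a∨b≤y i))))
  (λ t → let a≤y , b≤y = Equivalence.to T-∧ t in
    ≤ᵥ⇒≤ᵇᵥ (a ∨ᵥ b) y (λ i → ⊔-lub (≤ᵇᵥ⇒≤ᵥ a y a≤y i) (≤ᵇᵥ⇒≤ᵥ b y b≤y i)))

join-≤ᵇᵥ : ∀ {n} (x : Vec n) S y → (foldr _∨ᵥ_ x S ≤ᵇᵥ y) ≡ allᵇ (_≤ᵇᵥ y) (x ∷ S)
join-≤ᵇᵥ x []      y = sym (∧-identityʳ (x ≤ᵇᵥ y))
join-≤ᵇᵥ x (s ∷ S) y = begin
  (s ∨ᵥ foldr _∨ᵥ_ x S) ≤ᵇᵥ y                   ≡⟨ ∨ᵥ-≤ᵇᵥ s _ y ⟩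
  (s ≤ᵇᵥ y) ∧ (foldr _∨ᵥ_ x S ≤ᵇᵥ y)             ≡⟨ cong ((s ≤ᵇᵥ y) ∧_) (join-≤ᵇᵥ x S y) ⟩
  (s ≤ᵇᵥ y) ∧ ((x ≤ᵇᵥ y) ∧ allᵇ (_≤ᵇᵥ y) S)     ≡⟨ ∧-left-comm (s ≤ᵇᵥ y) (x ≤ᵇᵥ y) _ ⟩
  (x ≤ᵇᵥ y) ∧ ((s ≤ᵇᵥ y) ∧ allᵇ (_≤ᵇᵥ y) S)     ∎
  where open ≡-Reasoning

-- Sums over lists and inclusion–exclusion

private variable
  X Y : Set

∑ : (X → ℤ) → List X → ℤ
∑ f []       = 0ℤ
∑ f (x ∷ xs) = f x + ∑ f xs

∑-cong : ∀ {f g : X → ℤ} xs → (∀ {x} → x ∈ xs → f x ≡ g x) → ∑ f xs ≡ ∑ g xs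
∑-cong []       eq = refl
∑-cong (x ∷ xs) eq = cong₂ _+_ (eq (here refl)) (∑-cong xs (eq ∘ there))

∑-++ : ∀ (f : X → ℤ) xs ys → ∑ f (xs ++ ys) ≡ ∑ f xs + ∑ f ys
∑-++ f []       ys = sym (ℤ.+-identityˡ (∑ f ys))
∑-++ f (x ∷ xs) ys = trans (cong (λ s → f x + s) (∑-++ f xs ys)) (sym (ℤ.+-assoc (f x) _ _))

∑-map : ∀ (f : Y → ℤ) (g : X → Y) xs → ∑ f (map g xs) ≡ ∑ (f ∘ g) xs
∑-map f g []       = refl
∑-map f g (x ∷ xs) = cong (λ s → f (g x) + s) (∑-map f g xs)

∑-*ˡ : ∀ c (f : X → ℤ) xs → ∑ (λ x → c * f x) xs ≡ c * ∑ f xs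
∑-*ˡ c f []       = sym (ℤ.*-zeroʳ c)
∑-*ˡ c f (x ∷ xs) = trans (cong (λ s → c * f x + s) (∑-*ˡ c f xs)) (sym (ℤ.*-distribˡ-+ c (f x) _))

∑-subsets-∷ : ∀ (f : List X → ℤ) x xs →
  ∑ f (subsets (x ∷ xs)) ≡ ∑ (f ∘ (x ∷_)) (subsets xs) + ∑ f (subsets xs)
∑-subsets-∷ f x xs = trans (∑-++ f (map (x ∷_) (subsets xs)) (subsets xs))
                           (cong (_+ ∑ f (subsets xs)) (∑-map f (x ∷_) (subsets xs)))

subsets-⊆ : ∀ (P : List X) {S x} → S ∈ subsets P → x ∈ S → x ∈ P
subsets-⊆ []       (here refl) ()
subsets-⊆ (y ∷ ys) S∈ x∈S with ∈-++⁻ (map (y ∷_) (subsets ys)) S∈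
... | inj₂ S∈′ = there (subsets-⊆ ys S∈′ x∈S)
... | inj₁ yS∈ with ∈-map⁻ (y ∷_) yS∈ | x∈S
...   | _ , _   , refl | here refl = here refl
...   | _ , S′∈ , refl | there x∈S′ = there (subsets-⊆ ys S′∈ x∈S′)

sign : ℕ → ℤ
sign zero    = 1ℤ
sign (suc l) = - sign l

module InclusionExclusion {X : Set} (q : X → Bool) where

  inclusionTerm : List X → ℤ
  inclusionTerm []       = 0ℤ
  inclusionTerm (x ∷ xs) = sign (length xs) * 𝟙 (allᵇ q (x ∷ xs))

  alternating-sum : ∀ P → ∑ (λ S → sign (length S) * 𝟙 (allᵇ q S)) (subsets P) ≡ 𝟙 (not (any q P))
  alternating-sum []       = refl
  alternating-sum (x ∷ xs) = begin
    ∑ f (subsets (x ∷ xs))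
      ≡⟨ ∑-subsets-∷ f x xs ⟩
    ∑ (λ S → sign (length (x ∷ S)) * 𝟙 (allᵇ q (x ∷ S))) (subsets xs) + ∑ f (subsets xs)
      ≡⟨ cong (_+ ∑ f (subsets xs)) (∑-cong (subsets xs) λ {S} _ → factor (length S) (q x) (allᵇ q S)) ⟩
    ∑ (λ S → - 𝟙 (q x) * f S) (subsets xs) + ∑ f (subsets xs)
      ≡⟨ cong (_+ ∑ f (subsets xs)) (∑-*ˡ (- 𝟙 (q x)) f (subsets xs)) ⟩
    - 𝟙 (q x) * ∑ f (subsets xs) + ∑ f (subsets xs)
      ≡⟨ cong (λ z → - 𝟙 (q x) * z + z) (alternating-sum xs) ⟩
    - 𝟙 (q x) * 𝟙 (not (any q xs)) + 𝟙 (not (any q xs))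
      ≡⟨ combine (q x) (any q xs) ⟩
    𝟙 (not (q x ∨ any q xs)) ∎
    where
    open ≡-Reasoning
    f : List X → ℤ
    f S = sign (length S) * 𝟙 (allᵇ q S)
    factor : ∀ l a b → - sign l * 𝟙 (a ∧ b) ≡ - 𝟙 a * (sign l * 𝟙 b)
    factor l a b = trans (cong (- sign l *_) (𝟙-∧ a b)) (rearrange (sign l) (𝟙 a) (𝟙 b))
      where
      rearrange : ∀ s a b → - s * (a * b) ≡ - a * (s * b)
      rearrange = solve-∀
    combine : ∀ a b → - 𝟙 a * 𝟙 (not b) + 𝟙 (not b) ≡ 𝟙 (not (a ∨ b))
    combine true  true  = refl
    combine true  false = refl
    combine false true  = refl
    combine false false = refl

  inclusion-exclusion : ∀ P → ∑ inclusionTerm (subsets P) ≡ 𝟙 (any q P)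
  inclusion-exclusion []       = refl
  inclusion-exclusion (x ∷ xs) = begin
    ∑ inclusionTerm (subsets (x ∷ xs))
      ≡⟨ ∑-subsets-∷ inclusionTerm x xs ⟩
    ∑ (λ S → sign (length S) * 𝟙 (q x ∧ allᵇ q S)) (subsets xs) + ∑ inclusionTerm (subsets xs)
      ≡⟨ cong (_+ ∑ inclusionTerm (subsets xs)) (∑-cong (subsets xs) λ {S} _ → factor (length S) (q x) (allᵇ q S)) ⟩
    ∑ (λ S → 𝟙 (q x) * (sign (length S) * 𝟙 (allᵇ q S))) (subsets xs) + ∑ inclusionTerm (subsets xs)
      ≡⟨ cong₂ _+_ (∑-*ˡ (𝟙 (q x)) _ (subsets xs)) (inclusion-exclusion xs) ⟩
    𝟙 (q x) * ∑ (λ S → sign (length S) * 𝟙 (allᵇ q S)) (subsets xs) + 𝟙 (any q xs)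
      ≡⟨ cong (λ z → 𝟙 (q x) * z + 𝟙 (any q xs)) (alternating-sum xs) ⟩
    𝟙 (q x) * 𝟙 (not (any q xs)) + 𝟙 (any q xs)
      ≡⟨ combine (q x) (any q xs) ⟩
    𝟙 (q x ∨ any q xs) ∎
    where
    open ≡-Reasoning
    factor : ∀ l a b → sign l * 𝟙 (a ∧ b) ≡ 𝟙 a * (sign l * 𝟙 b)
    factor l a b = trans (cong (sign l *_) (𝟙-∧ a b)) (rearrange (sign l) (𝟙 a) (𝟙 b))
      where
      rearrange : ∀ s a b → s * (a * b) ≡ a * (s * b)
      rearrange = solve-∀
    combine : ∀ a b → 𝟙 a * 𝟙 (not b) + 𝟙 b ≡ 𝟙 (a ∨ b)
    combine true  true  = refl
    combine true  false = refl
    combine false true  = refl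
    combine false false = refl

signᵇ : Bool → ℤ
signᵇ true  = 1ℤ
signᵇ false = -1ℤ

signᵇ-isOdd-suc : ∀ l → signᵇ (isOdd (suc l)) ≡ sign l
signᵇ-isOdd-suc zero          = refl
signᵇ-isOdd-suc (suc zero)    = refl
signᵇ-isOdd-suc (suc (suc l)) = trans (signᵇ-isOdd-suc l) (sym (ℤ.neg-involutive (sign l)))

module _ {X : Set} (p q : X → Bool) where

  private
    count⁺ count⁻ : List X → ℤ
    count⁺ L = + length (filterᵇ (λ S → p S ∧ q S) L)
    count⁻ L = + length (filterᵇ (λ S → p S ∧ not (q S)) L)

  signed-count : ∀ L → count⁺ L - count⁻ L ≡ ∑ (λ S → 𝟙 (p S) * signᵇ (q S)) L
  signed-count []       = refl
  signed-count (x ∷ xs) with p x | q x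
  ... | true  | true  = trans (ℤ.+-assoc 1ℤ (count⁺ xs) (- count⁻ xs)) (cong (λ s → 1ℤ + s) (signed-count xs))
  ... | true  | false = trans (shift (count⁺ xs) (count⁻ xs)) (cong (λ s → -1ℤ + s) (signed-count xs))
    where
    shift : ∀ a b → a - (1ℤ + b) ≡ -1ℤ + (a - b)
    shift = solve-∀
  ... | false | _     = trans (signed-count xs) (sym (ℤ.+-identityˡ _))

-- The mixed difference Δ

-- Δ m g = ∑_{ε ∈ {0,1}ⁿ} (−1)^|ε| g (m − ε)
Δ : ∀ {n} → Vec n → (Vec n → ℤ) → ℤ
Δ {zero}  m g = g m
Δ {suc n} m g = Δ (V.tail m) (λ y → g (V.head m V.∷ y)) - Δ (V.tail m) (λ y → g ((V.head m ∸ 1) V.∷ y))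

∷-inStateSpace : ∀ {n} {m : Vec (suc n)} {a y} → a ≤ V.head m → InStateSpace (V.tail m) y → InStateSpace m (a V.∷ y)
∷-inStateSpace a≤ y∈ zero    = a≤
∷-inStateSpace a≤ y∈ (suc i) = y∈ i

Δ-cong : ∀ {n} (m : Vec n) {f g : Vec n → ℤ} → (∀ y → InStateSpace m y → f y ≡ g y) → Δ m f ≡ Δ m g
Δ-cong {zero}  m eq = eq m (λ ())
Δ-cong {suc n} m eq = cong₂ _-_
  (Δ-cong (V.tail m) λ y y∈ → eq _ (∷-inStateSpace ≤-refl y∈))
  (Δ-cong (V.tail m) λ y y∈ → eq _ (∷-inStateSpace (m∸n≤m _ 1) y∈))

Δ-+ : ∀ {n} (m : Vec n) (f g : Vec n → ℤ) → Δ m (λ y → f y + g y) ≡ Δ m f + Δ m g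
Δ-+ {zero}  m f g = refl
Δ-+ {suc n} m f g = trans
  (cong₂ _-_ (Δ-+ (V.tail m) f₁ g₁) (Δ-+ (V.tail m) f₀ g₀))
  (interchange (Δ (V.tail m) f₁) (Δ (V.tail m) g₁) (Δ (V.tail m) f₀) (Δ (V.tail m) g₀))
  where
  f₁ g₁ f₀ g₀ : Vec n → ℤ
  f₁ = f ∘ (V.head m V.∷_); g₁ = g ∘ (V.head m V.∷_)
  f₀ = f ∘ ((V.head m ∸ 1) V.∷_); g₀ = g ∘ ((V.head m ∸ 1) V.∷_)
  interchange : ∀ a b c d → (a + b) - (c + d) ≡ (a - c) + (b - d)
  interchange = solve-∀

Δ-sub : ∀ {n} (m : Vec n) (f g : Vec n → ℤ) → Δ m (λ y → f y - g y) ≡ Δ m f - Δ m g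
Δ-sub {zero}  m f g = refl
Δ-sub {suc n} m f g = trans
  (cong₂ _-_ (Δ-sub (V.tail m) f₁ g₁) (Δ-sub (V.tail m) f₀ g₀))
  (interchange (Δ (V.tail m) f₁) (Δ (V.tail m) g₁) (Δ (V.tail m) f₀) (Δ (V.tail m) g₀))
  where
  f₁ g₁ f₀ g₀ : Vec n → ℤ
  f₁ = f ∘ (V.head m V.∷_); g₁ = g ∘ (V.head m V.∷_)
  f₀ = f ∘ ((V.head m ∸ 1) V.∷_); g₀ = g ∘ ((V.head m ∸ 1) V.∷_)
  interchange : ∀ a b c d → (a - b) - (c - d) ≡ (a - c) - (b - d)
  interchange = solve-∀

Δ-*ˡ : ∀ {n} (m : Vec n) c (f : Vec n → ℤ) → Δ m (λ y → c * f y) ≡ c * Δ m f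
Δ-*ˡ {zero}  m c f = refl
Δ-*ˡ {suc n} m c f = trans
  (cong₂ _-_ (Δ-*ˡ (V.tail m) c (f ∘ (V.head m V.∷_))) (Δ-*ˡ (V.tail m) c (f ∘ ((V.head m ∸ 1) V.∷_))))
  (factor c (Δ (V.tail m) (f ∘ (V.head m V.∷_))) (Δ (V.tail m) (f ∘ ((V.head m ∸ 1) V.∷_))))
  where
  factor : ∀ c a b → c * a - c * b ≡ c * (a - b)
  factor = solve-∀

Δ-0 : ∀ {n} (m : Vec n) → Δ m (λ _ → 0ℤ) ≡ 0ℤ
Δ-0 {zero}  m = refl
Δ-0 {suc n} m = cong₂ _-_ (Δ-0 (V.tail m)) (Δ-0 (V.tail m))

Δ-∑ : ∀ {n} {X : Set} (m : Vec n) (t : X → Vec n → ℤ) xs →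
  Δ m (λ y → ∑ (λ s → t s y) xs) ≡ ∑ (λ s → Δ m (t s)) xs
Δ-∑ m t []       = Δ-0 m
Δ-∑ m t (s ∷ xs) = trans (Δ-+ m (t s) _) (cong (λ z → Δ m (t s) + z) (Δ-∑ m t xs))

Δ-upset : ∀ {n} (m v : Vec n) → (∀ i → 1 ≤ m i) → v ≤ᵥ m → Δ m (λ y → 𝟙 (v ≤ᵇᵥ y)) ≡ 𝟙 (v ≡ᵇᵥ m)
Δ-upset {zero}  m v _   _   = refl
Δ-upset {suc n} m v m≥1 v≤m = begin
  Δ m′ (λ y → 𝟙 (v ≤ᵇᵥ (m₀ V.∷ y))) - Δ m′ (λ y → 𝟙 (v ≤ᵇᵥ ((m₀ ∸ 1) V.∷ y)))
    ≡⟨ cong₂ _-_ (row m₀) (row (m₀ ∸ 1)) ⟩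
  𝟙 (v₀ ≤ᵇ m₀) * rest - 𝟙 (v₀ ≤ᵇ m₀ ∸ 1) * rest
    ≡⟨ factor (𝟙 (v₀ ≤ᵇ m₀)) (𝟙 (v₀ ≤ᵇ m₀ ∸ 1)) rest ⟩
  (𝟙 (v₀ ≤ᵇ m₀) - 𝟙 (v₀ ≤ᵇ m₀ ∸ 1)) * rest
    ≡⟨ cong (_* rest) (𝟙-≤ᵇ-pred (m≥1 zero) (v≤m zero)) ⟩
  𝟙 (v₀ ≡ᵇ m₀) * rest
    ≡⟨ sym (𝟙-∧ (v₀ ≡ᵇ m₀) _) ⟩
  𝟙 ((v₀ ≡ᵇ m₀) ∧ (V.tail v ≡ᵇᵥ m′))
    ≡⟨ cong 𝟙 (sym (allᵇ-allFin-suc (λ i → v i ≡ᵇ m i))) ⟩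
  𝟙 (v ≡ᵇᵥ m) ∎
  where
  open ≡-Reasoning
  m₀ v₀ : ℕ
  m₀ = m zero
  v₀ = v zero
  m′ : Vec n
  m′ = V.tail m
  rest : ℤ
  rest = 𝟙 (V.tail v ≡ᵇᵥ m′)
  factor : ∀ a b c → a * c - b * c ≡ (a - b) * c
  factor = solve-∀
  row : ∀ a → Δ m′ (λ y → 𝟙 (v ≤ᵇᵥ (a V.∷ y))) ≡ 𝟙 (v₀ ≤ᵇ a) * rest
  row a = begin
    Δ m′ (λ y → 𝟙 (v ≤ᵇᵥ (a V.∷ y)))
      ≡⟨ Δ-cong m′ (λ y _ → trans (cong 𝟙 (allᵇ-allFin-suc (λ i → v i ≤ᵇ (a V.∷ y) i))) (𝟙-∧ (v₀ ≤ᵇ a) _)) ⟩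
    Δ m′ (λ y → 𝟙 (v₀ ≤ᵇ a) * 𝟙 (V.tail v ≤ᵇᵥ y))
      ≡⟨ Δ-*ˡ m′ (𝟙 (v₀ ≤ᵇ a)) _ ⟩
    𝟙 (v₀ ≤ᵇ a) * Δ m′ (λ y → 𝟙 (V.tail v ≤ᵇᵥ y))
      ≡⟨ cong (𝟙 (v₀ ≤ᵇ a) *_) (Δ-upset m′ (V.tail v) (m≥1 ∘ suc) (v≤m ∘ suc)) ⟩
    𝟙 (v₀ ≤ᵇ a) * rest ∎

-- Minimal path vectors

allStates-sound : ∀ {n} (m : Vec n) {y} → y ∈ allStates m → InStateSpace m y
allStates-sound {zero}  m _ ()
allStates-sound {suc n} m y∈
  with find (∈-concatMap⁻ (λ a → map (a V.∷_) (allStates (V.tail m))) {xs = upTo (suc (m zero))} y∈)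
... | a , a∈ , y∈row with ∈-map⁻ (a V.∷_) y∈row
... | r , r∈ , refl = ∷-inStateSpace (≤-pred (∈-upTo⁻ a∈)) (allStates-sound (V.tail m) r∈)

allStates-complete : ∀ {n} (m : Vec n) y → InStateSpace m y → ∃[ y′ ] y′ ∈ allStates m × y′ ≗ y
allStates-complete {zero}  m y _  = _ , here refl , λ ()
allStates-complete {suc n} m y y∈ with allStates-complete (V.tail m) (V.tail y) (y∈ ∘ suc)
... | r , r∈ , r≗ = y zero V.∷ r
  , ∈-concatMap⁺ (λ a → map (a V.∷_) (allStates (V.tail m)))
      (lose (∈-upTo⁺ (s≤s (y∈ zero))) (∈-map⁺ (y zero V.∷_) r∈))
  , λ { zero → refl ; (suc i) → r≗ i }

Monotone : ∀ {n} → Vec n → (Vec n → ℕ) → Set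
Monotone m ψ = ∀ x y → InStateSpace m x → InStateSpace m y → x ≤ᵥ y → ψ x ≤ ψ y

sumᵥ : ∀ {n} → Vec n → ℕ
sumᵥ = V.foldr ℕ._+_ 0

sumᵥ-mono : ∀ {n} {x z : Vec n} → x ≤ᵥ z → sumᵥ x ≤ sumᵥ z
sumᵥ-mono {zero}  _   = z≤n
sumᵥ-mono {suc n} x≤z = +-mono-≤ (x≤z zero) (sumᵥ-mono (x≤z ∘ suc))

sumᵥ-< : ∀ {n} {x z : Vec n} → x ≤ᵥ z → ¬ x ≗ z → sumᵥ x < sumᵥ z
sumᵥ-< {zero}          _   x≢z = contradiction (λ ()) x≢z
sumᵥ-< {suc n} {x} {z} x≤z x≢z with x zero ≟ z zero
... | yes x₀≡z₀ = +-mono-≤-< (≤-reflexive x₀≡z₀)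
                    (sumᵥ-< (x≤z ∘ suc) (λ eq → x≢z λ { zero → x₀≡z₀ ; (suc i) → eq i }))
... | no  x₀≢z₀ = +-mono-<-≤ (≤∧≢⇒< (x≤z zero) x₀≢z₀) (sumᵥ-mono (x≤z ∘ suc))

module _ {n} (m : Vec n) (ψ : Vec n → ℕ) (k : ℕ) where

  minPath-sound : ∀ {p} → p ∈ minPaths m ψ k → InStateSpace m p × k ≤ ψ p
  minPath-sound {p} p∈ =
    let p∈′ , minimal = ∈-filter⁻ (T? ∘ isMinPath m ψ k) {xs = allStates m} p∈
    in allStates-sound m p∈′ , ≤ᵇ⇒≤ k (ψ p) (proj₁ (Equivalence.to T-∧ minimal))

  ¬isMinPath⇒smaller : ∀ {z} → k ≤ ψ z → ¬ T (isMinPath m ψ k z) →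
    ∃[ y ] y ∈ allStates m × y ≤ᵥ z × ¬ y ≗ z × k ≤ ψ y
  ¬isMinPath⇒smaller {z} k≤ψz ¬minimal =
    let y , y∈ , ¬below = find (¬All⇒Any¬ (T? ∘ q) (allStates m)
                            (¬minimal ∘ Equivalence.from T-∧ ∘ (≤⇒≤ᵇ k≤ψz ,_) ∘ allᵇ⁻ q))
        y≤z , y≢z , ψy≮k = decode (y ≤ᵇᵥ z) (y ≡ᵇᵥ z) (ψ y <ᵇ k) ¬below
    in y , y∈ , ≤ᵇᵥ⇒≤ᵥ y z y≤z , y≢z ∘ ≗⇒≡ᵇᵥ y z , ≮⇒≥ (ψy≮k ∘ <⇒<ᵇ)
    where
    q : Vec n → Bool
    q y = not ((y ≤ᵇᵥ z) ∧ not (y ≡ᵇᵥ z)) ∨ (ψ y <ᵇ k)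
    decode : ∀ a b c → ¬ T (not (a ∧ not b) ∨ c) → T a × ¬ T b × ¬ T c
    decode true  false false _ = _ , (λ ()) , (λ ())
    decode true  true  _     h = contradiction _ h
    decode true  false true  h = contradiction _ h
    decode false _     _     h = contradiction _ h

  minPath-below : ∀ z → z ∈ allStates m → k ≤ ψ z → ∃[ p ] p ∈ minPaths m ψ k × p ≤ᵥ z
  minPath-below = WF.All.wfRec (wellFounded sumᵥ <-wellFounded) _ Below step
    where
    Below : Vec n → Set
    Below z = z ∈ allStates m → k ≤ ψ z → ∃[ p ] p ∈ minPaths m ψ k × p ≤ᵥ z
    step : ∀ z → (∀ {y} → sumᵥ y < sumᵥ z → Below y) → Below z
    step z below z∈ k≤ψz with T? (isMinPath m ψ k z)
    ... | yes minimal = z , ∈-filter⁺ (T? ∘ isMinPath m ψ k) z∈ minimal , ≤ᵥ-refl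
    ... | no ¬minimal =
      let y , y∈ , y≤z , y≢z , k≤ψy = ¬isMinPath⇒smaller k≤ψz ¬minimal
          p , p∈ , p≤y = below (sumᵥ-< y≤z y≢z) y∈ k≤ψy
      in p , p∈ , ≤ᵥ-trans p≤y y≤z

  any-minPaths-below : Monotone m ψ → ∀ {y} → InStateSpace m y →
    any (_≤ᵇᵥ y) (minPaths m ψ k) ≡ (k ≤ᵇ ψ y)
  any-minPaths-below mono {y} y∈ = T-injective above below
    where
    above : T (any (_≤ᵇᵥ y) (minPaths m ψ k)) → T (k ≤ᵇ ψ y)
    above t =
      let p , p∈ , p≤y = find (any⁻ (_≤ᵇᵥ y) (minPaths m ψ k) t)
          p∈S , k≤ψp = minPath-sound p∈
      in ≤⇒≤ᵇ (≤-trans k≤ψp (mono p y p∈S y∈ (≤ᵇᵥ⇒≤ᵥ p y p≤y)))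
    below : T (k ≤ᵇ ψ y) → T (any (_≤ᵇᵥ y) (minPaths m ψ k))
    below t =
      let y′ , y′∈ , y′≗y = allStates-complete m y y∈
          k≤ψy′ = ≤-trans (≤ᵇ⇒≤ k (ψ y) t)
                    (mono y y′ y∈ (allStates-sound m y′∈) (≤-reflexive ∘ sym ∘ y′≗y))
          p , p∈ , p≤y′ = minPath-below y′ y′∈ k≤ψy′
      in any⁺ (_≤ᵇᵥ y) (lose p∈ (≤ᵥ⇒≤ᵇᵥ p y (λ i → ≤-trans (p≤y′ i) (≤-reflexive (y′≗y i)))))

-- Signed domination as a mixed difference

open InclusionExclusion using (inclusionTerm; inclusion-exclusion)

formationWeight : ∀ {n} → Vec n → List (Vec n) → ℤ
formationWeight m S = 𝟙 (isFormation m S) * signᵇ (isOdd (length S))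

formationWeight≡Δ : ∀ {n} (m : Vec n) → (∀ i → 1 ≤ m i) → ∀ {S} → All (_≤ᵥ m) S →
  formationWeight m S ≡ Δ m (λ y → inclusionTerm (_≤ᵇᵥ y) S)
formationWeight≡Δ m m≥1 {[]}     _   = sym (Δ-0 m)
formationWeight≡Δ m m≥1 {x ∷ xs} S≤m = begin
  𝟙 (join ≡ᵇᵥ m) * signᵇ (isOdd (suc (length xs)))
    ≡⟨ cong₂ _*_ (sym (Δ-upset m join m≥1 join≤m)) (signᵇ-isOdd-suc (length xs)) ⟩
  Δ m (λ y → 𝟙 (join ≤ᵇᵥ y)) * sign (length xs)
    ≡⟨ ℤ.*-comm _ (sign (length xs)) ⟩
  sign (length xs) * Δ m (λ y → 𝟙 (join ≤ᵇᵥ y))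
    ≡⟨ sym (Δ-*ˡ m (sign (length xs)) _) ⟩
  Δ m (λ y → sign (length xs) * 𝟙 (join ≤ᵇᵥ y))
    ≡⟨ Δ-cong m (λ y _ → cong (λ b → sign (length xs) * 𝟙 b) (join-≤ᵇᵥ x xs y)) ⟩
  Δ m (λ y → inclusionTerm (_≤ᵇᵥ y) (x ∷ xs)) ∎
  where
  open ≡-Reasoning
  join : Vec _
  join = foldr _∨ᵥ_ x xs
  join≤m : join ≤ᵥ m
  join≤m = ≤ᵇᵥ⇒≤ᵥ join m (subst T (sym (join-≤ᵇᵥ x xs m))
             (allᵇ⁻ (_≤ᵇᵥ m) (All.map (≤ᵥ⇒≤ᵇᵥ _ m) S≤m)))

𝟙-if : ∀ b → 𝟙 b ≡ + (if b then 1 else 0)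
𝟙-if true  = refl
𝟙-if false = refl

d≡Δ-level : ∀ {n} (m : Vec n) ψ k → (∀ i → 1 ≤ m i) → Monotone m ψ →
  d m ψ k ≡ Δ m (λ y → + level ψ k y)
d≡Δ-level m ψ k m≥1 mono = begin
  d m ψ k
    ≡⟨ signed-count (isFormation m) (isOdd ∘ length) 𝒮 ⟩
  ∑ (formationWeight m) 𝒮
    ≡⟨ ∑-cong 𝒮 (λ S∈ → formationWeight≡Δ m m≥1
         (All.tabulate (λ x∈S → proj₁ (minPath-sound m ψ k (subsets-⊆ P S∈ x∈S))))) ⟩
  ∑ (λ S → Δ m (λ y → inclusionTerm (_≤ᵇᵥ y) S)) 𝒮
    ≡⟨ sym (Δ-∑ m (λ S y → inclusionTerm (_≤ᵇᵥ y) S) 𝒮) ⟩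
  Δ m (λ y → ∑ (inclusionTerm (_≤ᵇᵥ y)) 𝒮)
    ≡⟨ Δ-cong m (λ y y∈ → begin
         ∑ (inclusionTerm (_≤ᵇᵥ y)) 𝒮    ≡⟨ inclusion-exclusion (_≤ᵇᵥ y) P ⟩
         𝟙 (any (_≤ᵇᵥ y) P)              ≡⟨ cong 𝟙 (any-minPaths-below m ψ k mono y∈) ⟩
         𝟙 (k ≤ᵇ ψ y)                    ≡⟨ 𝟙-if (k ≤ᵇ ψ y) ⟩
         + level ψ k y                   ∎) ⟩
  Δ m (λ y → + level ψ k y) ∎
  where
  open ≡-Reasoning
  P = minPaths m ψ k
  𝒮 = subsets P

-- Fixing the state of one component

insertAt-pointwise : ∀ {A : Set} {R : A → A → Set} {n} (e : Fin (suc n)) {x y : V.Vector A n} {a b} →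
  (∀ i → R (x i) (y i)) → R a b → ∀ j → R (V.insertAt x e a j) (V.insertAt y e b j)
insertAt-pointwise                     zero    xRy aRb zero    = aRb
insertAt-pointwise                     zero    xRy aRb (suc j) = xRy j
insertAt-pointwise         {n = suc n} (suc e) xRy aRb zero    = xRy zero
insertAt-pointwise {R = R} {n = suc n} (suc e) xRy aRb (suc j) = insertAt-pointwise {R = R} e (xRy ∘ suc) aRb j

insertAt-removeAt : ∀ {A : Set} {n} (x : V.Vector A (suc n)) e → V.insertAt (V.removeAt x e) e (x e) ≗ x
insertAt-removeAt             x zero    zero    = refl
insertAt-removeAt             x zero    (suc j) = refl
insertAt-removeAt {n = suc n} x (suc e) zero    = refl
insertAt-removeAt {n = suc n} x (suc e) (suc j) = insertAt-removeAt (V.tail x) e j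

insertAt-inStateSpace : ∀ {n} (m : Vec (suc n)) e {r y} → r ≤ m e →
  InStateSpace (V.removeAt m e) y → InStateSpace m (V.insertAt y e r)
insertAt-inStateSpace m e r≤ y∈ j =
  ≤-trans (insertAt-pointwise {R = _≤_} e y∈ r≤ j) (≤-reflexive (insertAt-removeAt m e j))

insertAt-monotone : ∀ {n} {m : Vec (suc n)} {ψ} e {r} → r ≤ m e → Monotone m ψ →
  Monotone (V.removeAt m e) (λ y → ψ (V.insertAt y e r))
insertAt-monotone e r≤ mono x y x∈ y∈ x≤y =
  mono _ _ (insertAt-inStateSpace _ e r≤ x∈) (insertAt-inStateSpace _ e r≤ y∈) (insertAt-pointwise {R = _≤_} e x≤y ≤-refl)

level-monotone : ∀ {n} {m : Vec n} {ψ} k → Monotone m ψ → Monotone m (level ψ k)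
level-monotone {ψ = ψ} k mono x y x∈ y∈ x≤y with k ≤ᵇ ψ x in k≤ψx | k ≤ᵇ ψ y in k≤ψy
... | false | _     = z≤n
... | true  | true  = ≤-refl
... | true  | false = contradiction
  (≤⇒≤ᵇ (≤-trans (≤ᵇ⇒≤ k (ψ x) (subst T (sym k≤ψx) _)) (mono x y x∈ y∈ x≤y))) (subst T k≤ψy)

level-level : ∀ {n} (ψ : Vec n → ℕ) k y → level (level ψ k) 1 y ≡ level ψ k y
level-level ψ k y with k ≤ᵇ ψ y
... | true  = refl
... | false = refl

-- Without function extensionality, insertAt y zero r and r ∷ y are only pointwise equal.
Extensional : ∀ {n} → Vec n → (Vec n → ℤ) → Set
Extensional m g = ∀ {x y} → InStateSpace m x → x ≗ y → g x ≡ g y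

level-extensional : ∀ {n} {m : Vec n} {ψ} k → Monotone m ψ → Extensional m (λ x → + level ψ k x)
level-extensional {m = m} {ψ} k mono {x} {y} x∈ x≗y = cong (λ v → + (if k ≤ᵇ v then 1 else 0))
  (≤-antisym (mono x y x∈ y∈ (≤-reflexive ∘ x≗y)) (mono y x y∈ x∈ (≤-reflexive ∘ sym ∘ x≗y)))
  where
  y∈ : InStateSpace m y
  y∈ i = subst (_≤ m i) (x≗y i) (x∈ i)

Δ-removeAt : ∀ {n} (m : Vec (suc n)) (g : Vec (suc n) → ℤ) → Extensional m g → ∀ e →
  Δ m g ≡ Δ (V.removeAt m e) (λ y → g (V.insertAt y e (m e)) - g (V.insertAt y e (m e ∸ 1)))
Δ-removeAt m g ext zero = begin
  Δ (V.tail m) (λ y → g (m zero V.∷ y)) - Δ (V.tail m) (λ y → g ((m zero ∸ 1) V.∷ y))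
    ≡⟨ sym (Δ-sub (V.tail m) _ _) ⟩
  Δ (V.tail m) (λ y → g (m zero V.∷ y) - g ((m zero ∸ 1) V.∷ y))
    ≡⟨ Δ-cong (V.tail m) (λ y y∈ → cong₂ _-_ (insert ≤-refl y∈) (insert (m∸n≤m _ 1) y∈)) ⟩
  Δ (V.tail m) (λ y → g (V.insertAt y zero (m zero)) - g (V.insertAt y zero (m zero ∸ 1))) ∎
  where
  open ≡-Reasoning
  insert : ∀ {a y} → a ≤ m zero → InStateSpace (V.tail m) y → g (a V.∷ y) ≡ g (V.insertAt y zero a)
  insert a≤ y∈ = ext (∷-inStateSpace a≤ y∈) λ { zero → refl ; (suc j) → refl }
Δ-removeAt {suc n} m g ext (suc e) = cong₂ _-_ (row ≤-refl) (row (m∸n≤m _ 1))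
  where
  r : ℕ
  r = m (suc e)
  m″ : Vec n
  m″ = V.removeAt (V.tail m) e
  row : ∀ {a} → a ≤ m zero → Δ (V.tail m) (λ y → g (a V.∷ y)) ≡
    Δ m″ (λ y → g (V.insertAt (a V.∷ y) (suc e) r) - g (V.insertAt (a V.∷ y) (suc e) (r ∸ 1)))
  row {a} a≤ = trans
    (Δ-removeAt (V.tail m) (λ y → g (a V.∷ y))
      (λ y∈ x≗y → ext (∷-inStateSpace a≤ y∈) λ { zero → refl ; (suc j) → x≗y j }) e)
    (Δ-cong m″ λ y y∈ → cong₂ _-_ (commute ≤-refl y∈) (commute (m∸n≤m r 1) y∈))
    where
    commute : ∀ {b y} → b ≤ r → InStateSpace m″ y →
      g (a V.∷ V.insertAt y e b) ≡ g (V.insertAt (a V.∷ y) (suc e) b)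
    commute b≤ y∈ = ext (∷-inStateSpace a≤ (insertAt-inStateSpace (V.tail m) e b≤ y∈))
      λ { zero → refl ; (suc j) → refl }

theorem4p4 : ∀ {n} (m : Vec (suc n)) (M : ℕ) (φ : Vec (suc n) → ℕ)
    → (∀ i → 1 ≤ m i)
    → (∀ x → InStateSpace m x → φ x ≤ M)
    → (∀ x y → InStateSpace m x → InStateSpace m y → x ≤ᵥ y → φ x ≤ φ y)
    → (k : ℕ) → 1 ≤ k → k ≤ M
    → (e : Fin (suc n))
    → d m φ k ≡ dFix m φ k e (m e) - dFix m φ k e (m e ∸ 1)
theorem4p4 {n} m _ φ m≥1 _ mono k _ _ e = begin
  d m φ k
    ≡⟨ d≡Δ-level m φ k m≥1 mono ⟩
  Δ m φₖ
    ≡⟨ Δ-removeAt m φₖ (level-extensional k mono) e ⟩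
  Δ m′ (λ y → φₖ (V.insertAt y e (m e)) - φₖ (V.insertAt y e (m e ∸ 1)))
    ≡⟨ Δ-sub m′ _ _ ⟩
  Δ m′ (λ y → φₖ (V.insertAt y e (m e))) - Δ m′ (λ y → φₖ (V.insertAt y e (m e ∸ 1)))
    ≡⟨ sym (cong₂ _-_ (dFix≡Δ ≤-refl) (dFix≡Δ (m∸n≤m _ 1))) ⟩
  dFix m φ k e (m e) - dFix m φ k e (m e ∸ 1) ∎
  where
  open ≡-Reasoning
  m′ : Vec n
  m′ = V.removeAt m e
  φₖ : Vec (suc n) → ℤ
  φₖ x = + level φ k x
  dFix≡Δ : ∀ {r} → r ≤ m e → dFix m φ k e r ≡ Δ m′ (λ y → φₖ (V.insertAt y e r))
  dFix≡Δ {r} r≤ = trans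
    (d≡Δ-level m′ (fixAt φ k e r) 1 (m≥1 ∘ punchIn e) (level-monotone k (insertAt-monotone e r≤ mono)))
    (Δ-cong m′ λ y _ → cong +_ (level-level (λ y → φ (V.insertAt y e r)) k y))
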